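{- Let $X$ be the set of shuffle tableaux of shape $(\lambda/\mu)\circledast(\nu/\rho)$ with entries in $[N]$ flagged by a nondecreasing flag, and let $x\in X$. If $f_{i+1}(x)$ contains an unpaired entry $i$ which is paired in $x$, then the rightmost (in the reading word) unpaired $i$ of $f^*_{i+1}(x)$ is also unpaired in $f_{i+1}(x)$.
   Context: A shuffle tableau of shape $(\lambda/\mu)\circledast(\nu/\rho)$ ($n$ rows each) is a pair $(T,U)$ of semistandard tableaux of shapes $\lambda/\mu$, $\nu/\rho$; row $r$ of $T$ at level $2r-1$, row $r$ of $U$ at level $2r$; entries are identified by their cells. Reading word: levels $2n,\dots,1$, each left to right. An $i$ in cell $(r,c)$ and $i+1$ in cell $(r+1,c)$ of the same tableau are column paired. For index $j$: remove column-paired $(j,j+1)$ pairs, bracket-match remaining $j$'s (")") with $j+1$'s ("("); an entry $j$ is paired if column paired or matched with a $j+1$, unpaired otherwise (so "unpaired $i$" means not paired with an $i+1$). $f_j$ changes the rightmost unpaired $j$ into $j+1$ ($0$ if none); $f_j^*(y)=f_j^k(y)$, $k\ge0$ maximal with $f_j^k(y)\ne0$. Flagged by $\vec b=(b_1\le\dots\le b_{2n})$: entries at level $\ell$ are $\le b_\ell$. -}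

module Defs where

open import Data.Bool using (Bool; true; false; if_then_else_; not; _∧_; _∨_)
open import Data.Nat using (ℕ; zero; suc; _+_; _*_; _∸_; _≤_; _<_; _≡ᵇ_; _≤ᵇ_; _<ᵇ_)
open import Data.Fin using (Fin)
import Data.Fin as Fin
open import Data.Vec using (Vec; []; _∷_; lookup)
open import Data.List using (List; []; _∷_; _++_; map; concatMap; upTo; downFrom; filterᵇ; last)
open import Data.Maybe using (Maybe; just; nothing)
open import Data.Product using (Σ; _×_; _,_)
open import Relation.Binary.PropositionalEquality using (_≡_)

-- Shapes (n rows each): λ/μ (tableau T) and ν/ρ (tableau U).
-- Rows and columns are 0-indexed natural numbers.  Row r of a
-- partition v : Vec ℕ n is  at v r  (0 for r ≥ n).

at : {n : ℕ} → Vec ℕ n → ℕ → ℕ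
at []       r       = 0
at (x ∷ xs) zero    = x
at (x ∷ xs) (suc r) = at xs r

IsPartition : {n : ℕ} → Vec ℕ n → Set
IsPartition {n} v = (i j : Fin n) → i Fin.≤ j → lookup v j ≤ lookup v i

Contained : {n : ℕ} → Vec ℕ n → Vec ℕ n → Set
Contained {n} inner outer = (i : Fin n) → lookup inner i ≤ lookup outer i

record Shape (n : ℕ) : Set where
  constructor shape
  field
    lam mu nu rho : Vec ℕ n

ValidShape : {n : ℕ} → Shape n → Set
ValidShape sh = IsPartition lam × IsPartition mu × IsPartition nu × IsPartition rho
              × Contained mu lam × Contained rho nu
  where open Shape sh

-- Cells: (tableau, row, column); tableau false = T, true = U.

Cell : Set
Cell = Bool × ℕ × ℕ

outerP innerP : {n : ℕ} → Shape n → Bool → Vec ℕ n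
outerP sh false = Shape.lam sh
outerP sh true  = Shape.nu sh
innerP sh false = Shape.mu sh
innerP sh true  = Shape.rho sh

inShapeᵇ : {n : ℕ} → Shape n → Cell → Bool
inShapeᵇ sh (t , r , c) = (at (innerP sh t) r ≤ᵇ c) ∧ (c <ᵇ at (outerP sh t) r)

InShape : {n : ℕ} → Shape n → Cell → Set
InShape sh (t , r , c) = at (innerP sh t) r ≤ c × c < at (outerP sh t) r

-- 0-indexed level: row r of T is at level 2r (paper: 2r-1, 1-indexed rows),
-- row r of U at level 2r+1 (paper: 2r).
level : Cell → ℕ
level (false , r , c) = 2 * r
level (true  , r , c) = 2 * r + 1

boolEq : Bool → Bool → Bool
boolEq false false = true
boolEq true  true  = true
boolEq _     _     = false

cellEq : Cell → Cell → Bool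
cellEq (t , r , c) (t' , r' , c') = boolEq t t' ∧ (r ≡ᵇ r') ∧ (c ≡ᵇ c')

-- A filling of the cells (values outside the shape are irrelevant).
Filling : Set
Filling = Cell → ℕ

Semistandard : {n : ℕ} → Shape n → ℕ → Filling → Set
Semistandard sh N F =
    ((x : Cell) → InShape sh x → 1 ≤ F x × F x ≤ N)
  × ((t : Bool) (r c : ℕ) → InShape sh (t , r , c) → InShape sh (t , r , suc c)
       → F (t , r , c) ≤ F (t , r , suc c))
  × ((t : Bool) (r c : ℕ) → InShape sh (t , r , c) → InShape sh (t , suc r , c)
       → F (t , r , c) < F (t , suc r , c))

-- flag b = (b_1 ≤ … ≤ b_2n), stored 0-indexed
IsFlag : {n : ℕ} → Vec ℕ (2 * n) → Set
IsFlag {n} b = (i j : Fin (2 * n)) → i Fin.≤ j → lookup b i ≤ lookup b j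

Flagged : {n : ℕ} → Shape n → Vec ℕ (2 * n) → Filling → Set
Flagged sh b F = (x : Cell) → InShape sh x → F x ≤ at b (level x)

IsShuffleTableau : {n : ℕ} → Shape n → ℕ → Vec ℕ (2 * n) → Filling → Set
IsShuffleTableau sh N b F = Semistandard sh N F × Flagged sh b F

-- Reading word: levels 2n,…,1, each left to right.

range : ℕ → ℕ → List ℕ
range a b = map (a +_) (upTo (b ∸ a))

rowCells : {n : ℕ} → Shape n → Bool → ℕ → List Cell
rowCells sh t r = map (λ c → (t , r , c)) (range (at (innerP sh t) r) (at (outerP sh t) r))

readingCells : {n : ℕ} → Shape n → List Cell
readingCells {n} sh = concatMap (λ r → rowCells sh true r ++ rowCells sh false r) (downFrom n)

colPairedᵇ : {n : ℕ} → Shape n → ℕ → Filling → Cell → Bool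
colPairedᵇ sh j F (t , r , c) =
     ((F (t , r , c) ≡ᵇ j) ∧ inShapeᵇ sh (t , suc r , c) ∧ (F (t , suc r , c) ≡ᵇ suc j))
  ∨ ((F (t , r , c) ≡ᵇ suc j) ∧ above r)
  where
  above : ℕ → Bool
  above zero     = false
  above (suc r') = inShapeᵇ sh (t , r' , c) ∧ (F (t , r' , c) ≡ᵇ j)

-- bracket matching: j+1 = "(" , j = ")"; k = number of open "(".
-- Returns the unmatched j's in reading order.
unmatched : ℕ → Filling → ℕ → List Cell → List Cell
unmatched j F k [] = []
unmatched j F k (x ∷ xs) with F x ≡ᵇ suc j | F x ≡ᵇ j | k
... | true  | _     | _      = unmatched j F (suc k) xs
... | false | true  | zero   = x ∷ unmatched j F zero xs
... | false | true  | suc k' = unmatched j F k' xs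
... | false | false | _      = unmatched j F k xs

unpaired : {n : ℕ} → Shape n → ℕ → Filling → List Cell
unpaired sh j F =
  unmatched j F 0 (filterᵇ (λ x → not (colPairedᵇ sh j F x)) (readingCells sh))

open import Data.List.Membership.Propositional using (_∈_; _∉_)

Paired : {n : ℕ} → Shape n → ℕ → Filling → Cell → Set
Paired sh j F e = e ∈ readingCells sh × F e ≡ j × e ∉ unpaired sh j F

Unpaired : {n : ℕ} → Shape n → ℕ → Filling → Cell → Set
Unpaired sh j F e = e ∈ unpaired sh j F

-- Crystal operators.  nothing represents 0.

update : Filling → Cell → ℕ → Filling
update F e v x = if cellEq x e then v else F x

f : {n : ℕ} → Shape n → ℕ → Filling → Maybe Filling
f sh j F with last (unpaired sh j F)
... | nothing = nothing
... | just e  = just (update F e (suc j))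

fIter : {n : ℕ} → Shape n → ℕ → ℕ → Filling → Maybe Filling
fIter sh j zero    F = just F
fIter sh j (suc k) F with fIter sh j k F
... | nothing = nothing
... | just G  = f sh j G

-- y = f_j^*(x): y = f_j^k(x) with k maximal such that f_j^k(x) ≠ 0,
-- i.e. f_j^k(x) = y and f_j(y) = 0.
FStar : {n : ℕ} → Shape n → ℕ → Filling → Filling → Set
FStar sh j x y = Σ ℕ (λ k → fIter sh j k x ≡ just y × f sh j y ≡ nothing)

module Submission where

-- For index i the reading word is a bracket word: an unpaired i+1 opens, an unpaired i
-- closes and column-paired entries are neutral, so the unpaired i's are the unmatched
-- closings.  f_{i+1} raises the last unmatched i+1, in cell d, and every further step of
-- f*_{i+1} raises an i+1 read before d.  Raising an i+1 can only lower brackets for i: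
-- an opening becomes neutral, or a column pair (i, i+1) breaks and its i becomes a
-- closing.  Lowering never matches a closing, so the last unmatched i of f_{i+1}(x)
-- stays unmatched, and it stays the last one unless a bracket changes at or after it.
-- Since e was paired in x, d is read before e, hence so is every raised cell; the i of
-- a pair broken by a raise is read before e too, by squeezing rows around d and e.

open import Data.Bool using (Bool; true; false; T; not; _∧_; _∨_; if_then_else_)
import Data.Bool as Bool
open import Data.Bool.Properties using (T-∧; T-∨)
open import Data.Empty using (⊥; ⊥-elim)
import Data.Fin as Fin
open import Data.List using (List; []; _∷_; _++_; last; concatMap; downFrom; filterᵇ)
open import Data.List.Membership.Propositional using (_∈_; _∉_)
open import Data.List.Membership.Propositional.Properties using (∈-++⁺ˡ; ∈-++⁺ʳ; ∈-++⁻; ∈-map⁻; ∈-upTo⁻)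
open import Data.List.Relation.Unary.All using (All; []; _∷_)
import Data.List.Relation.Unary.All as All
open import Data.List.Relation.Unary.AllPairs using (AllPairs; []; _∷_)
import Data.List.Relation.Unary.AllPairs.Properties as AllPairs
open import Data.List.Relation.Unary.Any using (here; there)
open import Data.List.Relation.Unary.Any.Properties using (¬Any[])
open import Data.Maybe using (just; nothing)
open import Data.Nat using (ℕ; zero; suc; _+_; _*_; _∸_; _≤_; _<_; z≤n; s≤s; _≡ᵇ_)
import Data.Nat as ℕ
open import Data.Nat.Properties
open import Data.Product using (Σ; _×_; _,_; proj₁; proj₂)
import Data.Product as Prod
open import Data.Product.Function.NonDependent.Propositional using (_×-⇔_)
open import Data.Product.Properties using () renaming (≡-dec to ×-≡-dec)
open import Data.Sum using (_⊎_; inj₁; inj₂)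
import Data.Sum as Sum
open import Data.Sum.Function.Propositional using (_⊎-⇔_)
open import Data.Vec using (Vec; []; _∷_)
open import Function using (_∘_; id; _⇔_; mk⇔; Equivalence)
open import Function.Properties.Equivalence using () renaming (trans to ⇔-trans)
open import Level using (0ℓ)
open import Relation.Binary using (Rel; IsStrictTotalOrder; Trichotomous; tri<; tri≈; tri>)
open import Relation.Binary.PropositionalEquality using (_≡_; _≢_; refl; sym; trans; cong; subst; subst₂; isEquivalence; module ≡-Reasoning)
open import Relation.Nullary using (¬_; Dec; yes; no; T?)
open import Relation.Nullary.Decidable using (map′)

open import Defs

data Bracket : Set where
  opening neutral closing : Bracket

weight : Bracket → ℕ
weight closing = 0
weight neutral = 1
weight opening = 2

_≟ᴮ_ : (a b : Bracket) → Dec (a ≡ b)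
opening ≟ᴮ opening = yes refl
neutral ≟ᴮ neutral = yes refl
closing ≟ᴮ closing = yes refl
opening ≟ᴮ neutral = no λ ()
opening ≟ᴮ closing = no λ ()
neutral ≟ᴮ opening = no λ ()
neutral ≟ᴮ closing = no λ ()
closing ≟ᴮ opening = no λ ()
closing ≟ᴮ neutral = no λ ()

_⊑_ : Bracket → Bracket → Set
a ⊑ b = weight a ≤ weight b

deepen : Bracket → ℕ → ℕ
deepen opening k       = suc k
deepen neutral k       = k
deepen closing zero    = zero
deepen closing (suc k) = k

unmatchedAt : Bracket → ℕ → Bool
unmatchedAt closing zero = true
unmatchedAt _       _    = false

unmatchedAt⇒closing : ∀ b k → T (unmatchedAt b k) → b ≡ closing × k ≡ 0
unmatchedAt⇒closing closing zero _ = refl , refl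

deepen-mono : ∀ {a b k l} → a ⊑ b → k ≤ l → deepen a k ≤ deepen b l
deepen-mono {opening} {opening} _ k≤l = s≤s k≤l
deepen-mono {neutral} {opening} _ k≤l = m≤n⇒m≤1+n k≤l
deepen-mono {neutral} {neutral} _ k≤l = k≤l
deepen-mono {closing} {b} {zero} _ _ = z≤n
deepen-mono {closing} {opening} {suc k} _ k≤l = m≤n⇒m≤1+n (≤-trans (n≤1+n k) k≤l)
deepen-mono {closing} {neutral} {suc k} _ k≤l = ≤-trans (n≤1+n k) k≤l
deepen-mono {closing} {closing} {suc k} {suc l} _ (s≤s k≤l) = k≤l
deepen-mono {opening} {neutral} (s≤s ())
deepen-mono {opening} {closing} ()
deepen-mono {neutral} {closing} ()

deepen-monoʳ : ∀ b {k l} → k ≤ l → deepen b k ≤ deepen b l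
deepen-monoʳ b = deepen-mono {b} {b} ≤-refl

unmatchedAt-antitone : ∀ b {k l} → k ≤ l → T (unmatchedAt b l) → T (unmatchedAt b k)
unmatchedAt-antitone closing {zero} {zero} _ t = t

module _ {A : Set} (s : A → Bracket) where

  -- k counts the openings read but not yet matched.
  unmatchedᴮ : ℕ → List A → List A
  unmatchedᴮ k []       = []
  unmatchedᴮ k (x ∷ xs) =
    if unmatchedAt (s x) k then x ∷ unmatchedᴮ (deepen (s x) k) xs
                           else unmatchedᴮ (deepen (s x) k) xs

  depth : ℕ → List A → ℕ
  depth k []       = k
  depth k (x ∷ xs) = depth (deepen (s x) k) xs

  unmatchedᴮ-⊆ : ∀ k L {y} → y ∈ unmatchedᴮ k L → y ∈ L
  unmatchedᴮ-⊆ k (x ∷ xs) p with unmatchedAt (s x) k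
  unmatchedᴮ-⊆ k (x ∷ xs) (here y≡x) | true = here y≡x
  unmatchedᴮ-⊆ k (x ∷ xs) (there p) | true = there (unmatchedᴮ-⊆ _ xs p)
  ... | false = there (unmatchedᴮ-⊆ _ xs p)

  unmatchedᴮ-closing : ∀ k L {y} → y ∈ unmatchedᴮ k L → s y ≡ closing
  unmatchedᴮ-closing k (x ∷ xs) p with unmatchedAt (s x) k in eq
  unmatchedᴮ-closing k (x ∷ xs) (here refl) | true = proj₁ (unmatchedAt⇒closing (s x) k (subst T (sym eq) _))
  unmatchedᴮ-closing k (x ∷ xs) (there p) | true = unmatchedᴮ-closing _ xs p
  ... | false = unmatchedᴮ-closing _ xs p

  unmatchedᴮ-++ : ∀ k P Q → unmatchedᴮ k (P ++ Q) ≡ unmatchedᴮ k P ++ unmatchedᴮ (depth k P) Q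
  unmatchedᴮ-++ k [] Q = refl
  unmatchedᴮ-++ k (x ∷ xs) Q with unmatchedAt (s x) k
  ... | true  = cong (x ∷_) (unmatchedᴮ-++ _ xs Q)
  ... | false = unmatchedᴮ-++ _ xs Q

  unmatchedᴮ-antitone : ∀ L {k l} → k ≤ l → ∀ {y} → y ∈ unmatchedᴮ l L → y ∈ unmatchedᴮ k L
  unmatchedᴮ-antitone (x ∷ xs) {k} {l} k≤l p with unmatchedAt (s x) l in eqₗ | unmatchedAt (s x) k in eqₖ
  ... | true | false = ⊥-elim (subst T eqₖ (unmatchedAt-antitone (s x) k≤l (subst T (sym eqₗ) _)))
  unmatchedᴮ-antitone (x ∷ xs) k≤l (here y≡x) | true | true = here y≡x
  unmatchedᴮ-antitone (x ∷ xs) k≤l (there p) | true | true = there (unmatchedᴮ-antitone xs (deepen-monoʳ (s x) k≤l) p)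
  ... | false | true  = there (unmatchedᴮ-antitone xs (deepen-monoʳ (s x) k≤l) p)
  ... | false | false = unmatchedᴮ-antitone xs (deepen-monoʳ (s x) k≤l) p

unmatchedᴮ-cong : ∀ {A : Set} {s t : A → Bracket} k L → (∀ {x} → x ∈ L → s x ≡ t x) →
  unmatchedᴮ s k L ≡ unmatchedᴮ t k L
unmatchedᴮ-cong k [] _ = refl
unmatchedᴮ-cong {s = s} {t} k (x ∷ xs) s≗t rewrite s≗t (here refl) =
  cong (λ l → if unmatchedAt (t x) k then x ∷ l else l) (unmatchedᴮ-cong _ xs (s≗t ∘ there))

depth-mono : ∀ {A : Set} {s t : A → Bracket} L {k l} → (∀ {x} → x ∈ L → t x ⊑ s x) → l ≤ k →
  depth t l L ≤ depth s k L
depth-mono []       _   l≤k = l≤k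
depth-mono (x ∷ xs) t⊑s l≤k = depth-mono xs (t⊑s ∘ there) (deepen-mono (t⊑s (here refl)) l≤k)

last-∈ : ∀ {A : Set} (L : List A) {a} → last L ≡ just a → a ∈ L
last-∈ (x ∷ [])     refl = here refl
last-∈ (x ∷ y ∷ L) p    = there (last-∈ (y ∷ L) p)

∈⇒last : ∀ {A : Set} {L : List A} {e} → e ∈ L → Σ A (λ a → last L ≡ just a)
∈⇒last {L = x ∷ []}    _ = x , refl
∈⇒last {L = x ∷ y ∷ L} _ = ∈⇒last {L = y ∷ L} (here refl)

last-∷ʳ : ∀ {A : Set} (P : List A) a → last (P ++ a ∷ []) ≡ just a
last-∷ʳ []          a = refl
last-∷ʳ (x ∷ [])    a = refl
last-∷ʳ (x ∷ y ∷ P) a = last-∷ʳ (y ∷ P) a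

last-∷ : ∀ {A : Set} (x : A) L {a} → last (x ∷ L) ≡ just a → (L ≡ [] × a ≡ x) ⊎ last L ≡ just a
last-∷ x []      refl = inj₁ (refl , refl)
last-∷ x (y ∷ L) p    = inj₂ p

record LastUnmatched {A : Set} (s : A → Bracket) (k : ℕ) (L : List A) (a : A) : Set where
  constructor split
  field
    prefix suffix : List A
    L≡ : L ≡ prefix ++ a ∷ suffix
    depth-prefix : depth s k prefix ≡ 0
    a-closing : s a ≡ closing
    suffix-matched : unmatchedᴮ s 0 suffix ≡ []

lastUnmatched-split : ∀ {A : Set} (s : A → Bracket) k L {a} → last (unmatchedᴮ s k L) ≡ just a → LastUnmatched s k L a
lastUnmatched-split s k (x ∷ xs) p with unmatchedAt (s x) k in eq
... | false with lastUnmatched-split s _ xs p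
...   | split P S L≡ dP sa uS = split (x ∷ P) S (cong (x ∷_) L≡) dP sa uS
lastUnmatched-split s k (x ∷ xs) p | true with unmatchedAt⇒closing (s x) k (subst T (sym eq) _)
...   | sx , refl rewrite sx with last-∷ x (unmatchedᴮ s 0 xs) p
...     | inj₁ (none , refl) = split [] xs refl refl sx none
...     | inj₂ q with lastUnmatched-split s 0 xs q
...       | split P S L≡ dP sa uS =
  split (x ∷ P) S (cong (x ∷_) L≡) (subst (λ b → depth s (deepen b 0) P ≡ 0) (sym sx) dP) sa uS

module BracketsInOrder {A : Set} {_≺_ : Rel A 0ℓ} (≺-sto : IsStrictTotalOrder _≡_ _≺_) where
  open IsStrictTotalOrder ≺-sto using (irrefl; asym; compare) renaming (trans to ≺-trans)

  _⪯_ : A → A → Set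
  a ⪯ b = a ≡ b ⊎ a ≺ b

  ≺-⪯-trans : ∀ {a b c} → a ≺ b → b ⪯ c → a ≺ c
  ≺-⪯-trans a≺b (inj₁ refl) = a≺b
  ≺-⪯-trans a≺b (inj₂ b≺c)  = ≺-trans a≺b b≺c

  Sorted : List A → Set
  Sorted = AllPairs _≺_

  Sorted-around : ∀ P {a} S → Sorted (P ++ a ∷ S) → All (_≺ a) P × All (a ≺_) S
  Sorted-around []      S (a≺S ∷ _)    = [] , a≺S
  Sorted-around (x ∷ P) S (x≺ ∷ sorted) =
    All.lookup x≺ (∈-++⁺ʳ P (here refl)) ∷ proj₁ (Sorted-around P S sorted) , proj₂ (Sorted-around P S sorted)

  module _ (s : A → Bracket) {L : List A} (sorted : Sorted L) where

    lastUnmatched-maximal : ∀ {a e} → last (unmatchedᴮ s 0 L) ≡ just a → e ∈ unmatchedᴮ s 0 L → e ⪯ a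
    lastUnmatched-maximal p m with lastUnmatched-split s 0 L p
    ... | split P S refl dP sa uS
      with ∈-++⁻ (unmatchedᴮ s 0 P) (subst (_ ∈_) (unmatchedᴮ-++ s 0 P (_ ∷ S)) m)
    ...   | inj₁ q = inj₂ (All.lookup (proj₁ (Sorted-around P S sorted)) (unmatchedᴮ-⊆ s 0 P q))
    ...   | inj₂ q rewrite dP | sa | uS with q
    ...     | here e≡a = inj₁ e≡a

    -- Lowering brackets never increases the depth, so a remains unmatched.
    lastUnmatched-stable : ∀ (t : A → Bracket) {a} → last (unmatchedᴮ s 0 L) ≡ just a →
      (∀ {c} → c ∈ L → t c ⊑ s c) → (∀ {c} → c ∈ L → ¬ c ≺ a → t c ≡ s c) →
      last (unmatchedᴮ t 0 L) ≡ just a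
    lastUnmatched-stable t {a} p t⊑s t≡s with lastUnmatched-split s 0 L p
    ... | split P S refl dP sa uS = begin
      last (unmatchedᴮ t 0 (P ++ a ∷ S))                          ≡⟨ cong last (unmatchedᴮ-++ t 0 P (a ∷ S)) ⟩
      last (unmatchedᴮ t 0 P ++ unmatchedᴮ t (depth t 0 P) (a ∷ S)) ≡⟨ cong (λ l → last (unmatchedᴮ t 0 P ++ l)) only-a ⟩
      last (unmatchedᴮ t 0 P ++ a ∷ [])                           ≡⟨ last-∷ʳ (unmatchedᴮ t 0 P) a ⟩
      just a                                                      ∎
      where
      open ≡-Reasoning
      a≺S : All (a ≺_) S
      a≺S = proj₂ (Sorted-around P S sorted)
      depth-prefixₜ : depth t 0 P ≡ 0
      depth-prefixₜ = n≤0⇒n≡0 (subst (depth t 0 P ≤_) dP (depth-mono P (t⊑s ∘ ∈-++⁺ˡ) z≤n))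
      ta : t a ≡ closing
      ta = trans (t≡s (∈-++⁺ʳ P (here refl)) (irrefl refl)) sa
      only-a : unmatchedᴮ t (depth t 0 P) (a ∷ S) ≡ a ∷ []
      only-a rewrite depth-prefixₜ | ta = cong (a ∷_) (trans
        (unmatchedᴮ-cong 0 S (λ m → t≡s (∈-++⁺ʳ P (there m)) (asym (All.lookup a≺S m)))) uS)

    lastUnmatched-opened : ∀ (t : A → Bracket) {u} → last (unmatchedᴮ s 0 L) ≡ just u → t u ≡ opening →
      (∀ {c} → c ∈ L → c ≢ u → t c ≡ s c) → ∀ {w} → w ∈ unmatchedᴮ t 0 L → w ≺ u
    lastUnmatched-opened t {u} p tu t≡s m with lastUnmatched-split s 0 L p
    ... | split P S refl dP su uS
      with ∈-++⁻ (unmatchedᴮ t 0 P) (subst (_ ∈_) (unmatchedᴮ-++ t 0 P (u ∷ S)) m)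
    ...   | inj₁ q = All.lookup P≺u (unmatchedᴮ-⊆ t 0 P q)
      where P≺u = proj₁ (Sorted-around P S sorted)
    ...   | inj₂ q rewrite tu =
      ⊥-elim (¬Any[] (subst (_ ∈_) uS (unmatchedᴮ-antitone s S z≤n (subst (_ ∈_) S-same q))))
      where
      u≺S = proj₂ (Sorted-around P S sorted)
      S-same : unmatchedᴮ t _ S ≡ unmatchedᴮ s _ S
      S-same = unmatchedᴮ-cong _ S λ c∈S →
        t≡s (∈-++⁺ʳ P (there c∈S)) λ { refl → irrefl refl (All.lookup u≺S c∈S) }

  unmatchedᴮ-or-change : ∀ (s t : A → Bracket) {L} → Sorted L → ∀ k {e} → e ∈ unmatchedᴮ s k L →
    e ∈ unmatchedᴮ t k L ⊎ Σ A (λ c → c ∈ L × c ⪯ e × s c ≢ t c)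
  unmatchedᴮ-or-change s t {x ∷ xs} (x≺ ∷ sorted) k {e} m with s x ≟ᴮ t x
  ... | no sx≢tx with compare x e
  ...   | tri< x≺e _ _ = inj₂ (x , here refl , inj₂ x≺e , sx≢tx)
  ...   | tri≈ _ x≡e _ = inj₂ (x , here refl , inj₁ x≡e , sx≢tx)
  ...   | tri> _ _ e≺x with unmatchedᴮ-⊆ s k (x ∷ xs) m
  ...     | here refl = ⊥-elim (irrefl refl e≺x)
  ...     | there e∈xs = ⊥-elim (asym e≺x (All.lookup x≺ e∈xs))
  unmatchedᴮ-or-change s t {x ∷ xs} (x≺ ∷ sorted) k {e} m | yes sx≡tx
    with s x | t x | sx≡tx
  ... | b | .b | refl with unmatchedAt b k
  unmatchedᴮ-or-change s t (x≺ ∷ sorted) k (here e≡x) | yes _ | b | .b | refl | true = inj₁ (here e≡x)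
  unmatchedᴮ-or-change s t (x≺ ∷ sorted) k (there m) | yes _ | b | .b | refl | true =
    Sum.map there (Prod.map₂ (Prod.map₁ there)) (unmatchedᴮ-or-change s t sorted (deepen b k) m)
  ... | false = Sum.map₂ (Prod.map₂ (Prod.map₁ there)) (unmatchedᴮ-or-change s t sorted (deepen b k) m)

column : Cell → ℕ
column (_ , _ , c) = c

-- The reading word reads higher levels first, each level from left to right.
data _≺_ (a b : Cell) : Set where
  by-level  : level b < level a → a ≺ b
  by-column : level a ≡ level b → column a < column b → a ≺ b

level-injective : ∀ {t t′ r r′ c c′} → level (t , r , c) ≡ level (t′ , r′ , c′) → t ≡ t′ × r ≡ r′
level-injective {false} {false} {r} {r′} p = refl , *-cancelˡ-≡ r r′ 2 p
level-injective {false} {true}  {r} {r′} p = ⊥-elim (even≢odd r r′ (trans p (+-comm (2 * r′) 1)))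
level-injective {true}  {false} {r} {r′} p = ⊥-elim (even≢odd r′ r (trans (sym p) (+-comm (2 * r) 1)))
level-injective {true}  {true}  {r} {r′} p = refl , *-cancelˡ-≡ r r′ 2 (+-cancelʳ-≡ 1 (2 * r) (2 * r′) p)

level-column-injective : ∀ {a b} → level a ≡ level b → column a ≡ column b → a ≡ b
level-column-injective {t , r , c} {t′ , r′ , .c} p refl with level-injective {t} {t′} {r} {r′} {c} {c} p
... | refl , refl = refl

≺-irrefl : ∀ {a b} → a ≡ b → ¬ a ≺ b
≺-irrefl refl (by-level p)    = <-irrefl refl p
≺-irrefl refl (by-column _ p) = <-irrefl refl p

≺-trans : ∀ {a b c} → a ≺ b → b ≺ c → a ≺ c
≺-trans (by-level p)     (by-level q)     = by-level (<-trans q p)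
≺-trans (by-level p)     (by-column q _)  = by-level (subst (_< _) q p)
≺-trans (by-column p _)  (by-level q)     = by-level (subst (_ <_) (sym p) q)
≺-trans (by-column p p′) (by-column q q′) = by-column (trans p q) (<-trans p′ q′)

≺-compare : Trichotomous _≡_ _≺_
≺-compare a b with <-cmp (level a) (level b)
... | tri< p _ _ = tri> (λ { (by-level q) → <-asym p q ; (by-column q _) → <-irrefl q p })
                        (λ { refl → <-irrefl refl p }) (by-level p)
... | tri> _ _ p = tri< (by-level p) (λ { refl → <-irrefl refl p })
                        (λ { (by-level q) → <-asym p q ; (by-column q _) → <-irrefl q p })
... | tri≈ _ e _ with <-cmp (column a) (column b)
...   | tri< p _ _ = tri< (by-column e p) (λ { refl → <-irrefl refl p })
                          (λ { (by-level q) → <-irrefl e q ; (by-column _ q) → <-asym p q })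
...   | tri≈ _ e′ _ = tri≈ (λ { (by-level q) → <-irrefl (sym e) q ; (by-column _ q) → <-irrefl e′ q })
                           (level-column-injective e e′)
                           (λ { (by-level q) → <-irrefl e q ; (by-column _ q) → <-irrefl (sym e′) q })
...   | tri> _ _ p = tri> (λ { (by-level q) → <-irrefl (sym e) q ; (by-column _ q) → <-asym p q })
                          (λ { refl → <-irrefl refl p }) (by-column (sym e) p)

≺-isStrictTotalOrder : IsStrictTotalOrder _≡_ _≺_
≺-isStrictTotalOrder = record
  { isStrictPartialOrder = record
    { isEquivalence = isEquivalence
    ; irrefl = ≺-irrefl
    ; trans = ≺-trans
    ; <-resp-≈ = (λ { refl a≺b → a≺b }) , (λ { refl a≺b → a≺b })
    }
  ; compare = ≺-compare
  }

open BracketsInOrder ≺-isStrictTotalOrder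

i<n∸m⇒m+i<n : ∀ m n {i} → i < n ∸ m → m + i < n
i<n∸m⇒m+i<n zero    n       p = p
i<n∸m⇒m+i<n (suc m) (suc n) p = s≤s (i<n∸m⇒m+i<n m n p)

∈-rowCells⁻ : ∀ {n} (sh : Shape n) {t r x} → x ∈ rowCells sh t r →
  Σ ℕ (λ c → x ≡ (t , r , c) × InShape sh (t , r , c))
∈-rowCells⁻ sh {t} {r} m
  with _ , c∈ , refl ← ∈-map⁻ (λ c → (t , r , c)) m
  with i , i∈ , refl ← ∈-map⁻ (_ +_) c∈ =
  _ , refl , m≤m+n _ i , i<n∸m⇒m+i<n _ _ (∈-upTo⁻ i∈)

rowBlock : ∀ {n} → Shape n → ℕ → List Cell
rowBlock sh r = rowCells sh true r ++ rowCells sh false r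

∈-rowBlock⁻ : ∀ {n} (sh : Shape n) {r x} → x ∈ rowBlock sh r →
  Σ Bool (λ t → Σ ℕ (λ c → x ≡ (t , r , c) × InShape sh (t , r , c)))
∈-rowBlock⁻ sh {r} m with ∈-++⁻ (rowCells sh true r) m
... | inj₁ q = true  , ∈-rowCells⁻ sh q
... | inj₂ q = false , ∈-rowCells⁻ sh q

level≤ : ∀ t r c → level (t , r , c) ≤ 2 * r + 1
level≤ false r c = m≤m+n (2 * r) 1
level≤ true  r c = ≤-refl

level≥ : ∀ t r c → 2 * r ≤ level (t , r , c)
level≥ false r c = ≤-refl
level≥ true  r c = m≤m+n (2 * r) 1

row<⇒level< : ∀ {t t′ r r′ c c′} → r′ < r → level (t′ , r′ , c′) < level (t , r , c)
row<⇒level< {t} {t′} {r} {r′} {c} {c′} r′<r = begin-strict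
  level (t′ , r′ , c′) ≤⟨ level≤ t′ r′ c′ ⟩
  2 * r′ + 1           ≡⟨ +-comm (2 * r′) 1 ⟩
  suc (2 * r′)         <⟨ n<1+n _ ⟩
  2 + 2 * r′           ≡⟨ *-suc 2 r′ ⟨
  2 * suc r′           ≤⟨ *-monoʳ-≤ 2 r′<r ⟩
  2 * r                ≤⟨ level≥ t r c ⟩
  level (t , r , c)    ∎
  where open ≤-Reasoning

rowCells-sorted : ∀ {n} (sh : Shape n) t r → Sorted (rowCells sh t r)
rowCells-sorted sh t r =
  AllPairs.map⁺ (AllPairs.map⁺ (AllPairs.applyUpTo⁺₁ id _ λ i<j _ → by-column (level-column t) (+-monoʳ-< _ i<j)))
  where
  level-column : ∀ t {c c′} → level (t , r , c) ≡ level (t , r , c′)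
  level-column false = refl
  level-column true  = refl

rowBlock-sorted : ∀ {n} (sh : Shape n) r → Sorted (rowBlock sh r)
rowBlock-sorted sh r = AllPairs.++⁺ (rowCells-sorted sh true r) (rowCells-sorted sh false r)
  (All.tabulate λ x∈ → All.tabulate λ y∈ → U≺T x∈ y∈)
  where
  U≺T : ∀ {x y} → x ∈ rowCells sh true r → y ∈ rowCells sh false r → x ≺ y
  U≺T x∈ y∈ with _ , refl , _ ← ∈-rowCells⁻ sh x∈ | _ , refl , _ ← ∈-rowCells⁻ sh y∈ =
    by-level (subst (2 * r <_) (+-comm 1 (2 * r)) ≤-refl)

rowBlocks : ∀ {n} → Shape n → ℕ → List Cell
rowBlocks sh m = concatMap (rowBlock sh) (downFrom m)

∈-rowBlocks⁻ : ∀ {n} (sh : Shape n) m {x} → x ∈ rowBlocks sh m →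
  Σ Bool (λ t → Σ ℕ (λ r → Σ ℕ (λ c → x ≡ (t , r , c) × r < m × InShape sh (t , r , c))))
∈-rowBlocks⁻ sh (suc m) x∈ with ∈-++⁻ (rowBlock sh m) x∈
... | inj₁ q with t , c , refl , inS ← ∈-rowBlock⁻ sh q = t , m , c , refl , ≤-refl , inS
... | inj₂ q with t , r , c , refl , r<m , inS ← ∈-rowBlocks⁻ sh m q = t , r , c , refl , m<n⇒m<1+n r<m , inS

rowBlocks-sorted : ∀ {n} (sh : Shape n) m → Sorted (rowBlocks sh m)
rowBlocks-sorted sh zero    = []
rowBlocks-sorted sh (suc m) = AllPairs.++⁺ (rowBlock-sorted sh m) (rowBlocks-sorted sh m)
  (All.tabulate λ x∈ → All.tabulate λ y∈ → higher≺lower x∈ y∈)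
  where
  higher≺lower : ∀ {x y} → x ∈ rowBlock sh m → y ∈ rowBlocks sh m → x ≺ y
  higher≺lower x∈ y∈ with t , c , refl , _ ← ∈-rowBlock⁻ sh x∈ | t′ , _ , c′ , refl , r′<m , _ ← ∈-rowBlocks⁻ sh m y∈ =
    by-level (row<⇒level< {t} {t′} {c = c} {c′} r′<m)

readingCells-sorted : ∀ {n} (sh : Shape n) → Sorted (readingCells sh)
readingCells-sorted {n} sh = rowBlocks-sorted sh n

readingCells-inShape : ∀ {n} (sh : Shape n) {x} → x ∈ readingCells sh → InShape sh x
readingCells-inShape {n} sh x∈ with _ , _ , _ , refl , _ , inS ← ∈-rowBlocks⁻ sh n x∈ = inS

at-antitone : ∀ {n} (v : Vec ℕ n) → IsPartition v → ∀ r → at v (suc r) ≤ at v r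
at-antitone []           _ r       = z≤n
at-antitone (x ∷ [])     _ zero    = z≤n
at-antitone (x ∷ y ∷ ys) P zero    = P Fin.zero (Fin.suc Fin.zero) z≤n
at-antitone (x ∷ xs)     P (suc r) = at-antitone xs (λ i j i≤j → P (Fin.suc i) (Fin.suc j) (s≤s i≤j)) r

module _ {n} {sh : Shape n} (valid : ValidShape sh) where
  private
    open Shape sh
    λ-partition = proj₁ valid
    μ-partition = proj₁ (proj₂ valid)
    ν-partition = proj₁ (proj₂ (proj₂ valid))
    ρ-partition = proj₁ (proj₂ (proj₂ (proj₂ valid)))

  innerP-antitone : ∀ t r → at (innerP sh t) (suc r) ≤ at (innerP sh t) r
  innerP-antitone false = at-antitone mu μ-partition
  innerP-antitone true  = at-antitone rho ρ-partition

  outerP-antitone : ∀ t r → at (outerP sh t) (suc r) ≤ at (outerP sh t) r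
  outerP-antitone false = at-antitone lam λ-partition
  outerP-antitone true  = at-antitone nu ν-partition

below : Cell → Cell
below (t , r , c) = (t , suc r , c)

level-below : ∀ c → level (below c) ≡ 2 + level c
level-below (false , r , _) = *-suc 2 r
level-below (true  , r , _) = cong (_+ 1) (*-suc 2 r)

below-≺ : ∀ c → below c ≺ c
below-≺ c = by-level (subst (level c <_) (sym (level-below c)) (m<n+m (level c) (s≤s z≤n)))

below-≺-below⁻ : ∀ {a b} → below a ≺ below b → a ≺ b
below-≺-below⁻ {a} {b} (by-level p) rewrite level-below a | level-below b = by-level (+-cancelˡ-< 2 _ _ p)
below-≺-below⁻ {a} {b} (by-column p q) rewrite level-below a | level-below b = by-column (+-cancelˡ-≡ 2 _ _ p) q

module Semistandardness {n} {sh : Shape n} {N} {F : Filling} (valid : ValidShape sh) (ss : Semistandard sh N F) where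
  private
    row-weak = proj₁ (proj₂ ss)
    column-strict = proj₂ (proj₂ ss)

  row-mono : ∀ {t r a b} → a ≤ b → InShape sh (t , r , a) → InShape sh (t , r , b) → F (t , r , a) ≤ F (t , r , b)
  row-mono {b = zero} z≤n _ _ = ≤-refl
  row-mono {t} {r} {a} {suc b} a≤b a∈ b∈ with m≤n⇒m<n∨m≡n a≤b
  ... | inj₂ refl = ≤-refl
  ... | inj₁ (s≤s a≤b′) = ≤-trans (row-mono a≤b′ a∈ b′∈) (row-weak t r b b′∈ b∈)
    where b′∈ = ≤-trans (proj₁ a∈) a≤b′ , <-trans (n<1+n b) (proj₂ b∈)

  squeeze-above : ∀ {t r a b v} → a ≤ b → InShape sh (t , r , a) → InShape sh (t , suc r , b) →
    F (t , r , a) ≡ v → F (t , suc r , b) ≡ suc v → InShape sh (t , r , b) × F (t , r , b) ≡ v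
  squeeze-above {t} {r} {a} {b} a≤b a∈ b∈ Fa Fb = b∈′ ,
    ≤-antisym (≤-pred (subst (F (t , r , b) <_) Fb (column-strict t r b b∈′ b∈)))
              (subst (_≤ F (t , r , b)) Fa (row-mono a≤b a∈ b∈′))
    where b∈′ = ≤-trans (proj₁ a∈) a≤b , <-≤-trans (proj₂ b∈) (outerP-antitone valid t r)

  squeeze-below : ∀ {t r a b v} → a ≤ b → InShape sh (t , r , a) → InShape sh (t , suc r , b) →
    F (t , r , a) ≡ v → F (t , suc r , b) ≡ suc v → InShape sh (t , suc r , a) × F (t , suc r , a) ≡ suc v
  squeeze-below {t} {r} {a} {b} a≤b a∈ b∈ Fa Fb = a∈′ ,
    ≤-antisym (subst (F (t , suc r , a) ≤_) Fb (row-mono a≤b a∈′ b∈))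
              (subst (_< F (t , suc r , a)) Fa (column-strict t r a a∈ a∈′))
    where a∈′ = ≤-trans (innerP-antitone valid t r) (proj₁ a∈) , ≤-<-trans a≤b (proj₂ b∈)

  ≺⇒level< : ∀ {d e} → InShape sh d → InShape sh e → F e < F d → d ≺ e → level e < level d
  ≺⇒level< _ _ _ (by-level p) = p
  ≺⇒level< {t , r , c} {t′ , r′ , c′} d∈ e∈ Fe<Fd (by-column p c<c′)
    with level-injective {t} {t′} {r} {r′} {c} {c′} p
  ... | refl , refl = ⊥-elim (<⇒≱ Fe<Fd (row-mono (<⇒≤ c<c′) d∈ e∈))

module _ {n} (sh : Shape n) (j : ℕ) (F : Filling) where

  PairedBelow : Cell → Set
  PairedBelow c = F c ≡ j × InShape sh (below c) × F (below c) ≡ suc j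

  PairedAbove : Cell → Set
  PairedAbove (t , zero  , c) = ⊥
  PairedAbove (t , suc r , c) = F (t , suc r , c) ≡ suc j × InShape sh (t , r , c) × F (t , r , c) ≡ j

  ColPaired : Cell → Set
  ColPaired c = PairedBelow c ⊎ PairedAbove c

PairedAbove⇒entry : ∀ {n} (sh : Shape n) j F c → PairedAbove sh j F c → F c ≡ suc j
PairedAbove⇒entry sh j F (t , suc r , col) (Fc , _) = Fc

T-≡ᵇ : ∀ {m n} → T (m ≡ᵇ n) ⇔ m ≡ n
T-≡ᵇ = mk⇔ (≡ᵇ⇒≡ _ _) (≡⇒≡ᵇ _ _)

T-inShapeᵇ : ∀ {n} (sh : Shape n) x → T (inShapeᵇ sh x) ⇔ InShape sh x
T-inShapeᵇ sh (t , r , c) = ⇔-trans T-∧ (mk⇔ (≤ᵇ⇒≤ _ _) ≤⇒≤ᵇ ×-⇔ mk⇔ (<ᵇ⇒< _ _) <⇒<ᵇ)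

T-pairedBelowᵇ : ∀ {n} (sh : Shape n) j F {t r c} →
  T ((F (t , r , c) ≡ᵇ j) ∧ inShapeᵇ sh (t , suc r , c) ∧ (F (t , suc r , c) ≡ᵇ suc j)) ⇔ PairedBelow sh j F (t , r , c)
T-pairedBelowᵇ sh j F {t} {r} {c} = ⇔-trans T-∧ (T-≡ᵇ ×-⇔ ⇔-trans T-∧ (T-inShapeᵇ sh (t , suc r , c) ×-⇔ T-≡ᵇ))

T-colPairedᵇ : ∀ {n} (sh : Shape n) j F c → T (colPairedᵇ sh j F c) ⇔ ColPaired sh j F c
T-colPairedᵇ sh j F (t , zero , c) =
  ⇔-trans T-∨ (T-pairedBelowᵇ sh j F ⊎-⇔ mk⇔ (proj₂ ∘ Equivalence.to T-∧) λ ())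
T-colPairedᵇ sh j F (t , suc r , c) =
  ⇔-trans T-∨ (T-pairedBelowᵇ sh j F ⊎-⇔ ⇔-trans T-∧ (T-≡ᵇ ×-⇔ ⇔-trans T-∧ (T-inShapeᵇ sh (t , r , c) ×-⇔ T-≡ᵇ)))

entryBracket : ℕ → ℕ → Bracket
entryBracket j v = if v ≡ᵇ suc j then opening else if v ≡ᵇ j then closing else neutral

bracketOf : ∀ {n} → Shape n → ℕ → Filling → Cell → Bracket
bracketOf sh j F c = if colPairedᵇ sh j F c then neutral else entryBracket j (F c)

unpaired≡unmatchedᴮ : ∀ {n} (sh : Shape n) j F →
  unpaired sh j F ≡ unmatchedᴮ (bracketOf sh j F) 0 (readingCells sh)
unpaired≡unmatchedᴮ sh j F = go 0 (readingCells sh)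
  where
  go : ∀ k L → unmatched j F k (filterᵇ (not ∘ colPairedᵇ sh j F) L) ≡ unmatchedᴮ (bracketOf sh j F) k L
  go k [] = refl
  go k (x ∷ L) with colPairedᵇ sh j F x
  ... | true = go k L
  ... | false with F x ≡ᵇ suc j | F x ≡ᵇ j | k
  ...   | true  | _     | k′     = go (suc k′) L
  ...   | false | true  | zero   = cong (x ∷_) (go zero L)
  ...   | false | true  | suc k′ = go k′ L
  ...   | false | false | k′     = go k′ L

entryBracket-opening : ∀ j {v} → v ≡ suc j → entryBracket j v ≡ opening
entryBracket-opening j {v} v≡ with v ≡ᵇ suc j in eq
... | true  = refl
... | false = ⊥-elim (subst T eq (≡⇒≡ᵇ v (suc j) v≡))

entryBracket-closing : ∀ j {v} → v ≡ j → entryBracket j v ≡ closing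
entryBracket-closing j {v} v≡ with v ≡ᵇ suc j in eq₁ | v ≡ᵇ j in eq₂
... | true  | _     = ⊥-elim (1+n≢n (trans (sym (≡ᵇ⇒≡ v (suc j) (subst T (sym eq₁) _))) v≡))
... | false | true  = refl
... | false | false = ⊥-elim (subst T eq₂ (≡⇒≡ᵇ v j v≡))

entryBracket-neutral : ∀ j {v} → v ≢ j → v ≢ suc j → entryBracket j v ≡ neutral
entryBracket-neutral j {v} v≢j v≢1+j with v ≡ᵇ suc j in eq₁ | v ≡ᵇ j in eq₂
... | true  | _     = ⊥-elim (v≢1+j (≡ᵇ⇒≡ v (suc j) (subst T (sym eq₁) _)))
... | false | true  = ⊥-elim (v≢j (≡ᵇ⇒≡ v j (subst T (sym eq₂) _)))
... | false | false = refl

entryBracket≡closing⇒ : ∀ j {v} → entryBracket j v ≡ closing → v ≡ j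
entryBracket≡closing⇒ j {v} p with v ≡ᵇ suc j | v ≡ᵇ j in eq
... | false | true = ≡ᵇ⇒≡ v j (subst T (sym eq) _)

module _ {n} (sh : Shape n) (j : ℕ) (F : Filling) (c : Cell) where

  bracketOf-paired : ColPaired sh j F c → bracketOf sh j F c ≡ neutral
  bracketOf-paired p with colPairedᵇ sh j F c in eq
  ... | true  = refl
  ... | false = ⊥-elim (subst T eq (Equivalence.from (T-colPairedᵇ sh j F c) p))

  bracketOf-unpaired : ¬ ColPaired sh j F c → bracketOf sh j F c ≡ entryBracket j (F c)
  bracketOf-unpaired ¬p with colPairedᵇ sh j F c in eq
  ... | true  = ⊥-elim (¬p (Equivalence.to (T-colPairedᵇ sh j F c) (subst T (sym eq) _)))
  ... | false = refl

  bracketOf-neutral : F c ≢ j → F c ≢ suc j → bracketOf sh j F c ≡ neutral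
  bracketOf-neutral Fc≢j Fc≢1+j with colPairedᵇ sh j F c
  ... | true  = refl
  ... | false = entryBracket-neutral j Fc≢j Fc≢1+j

  bracketOf≡closing⇒ : bracketOf sh j F c ≡ closing → F c ≡ j × ¬ ColPaired sh j F c
  bracketOf≡closing⇒ p with colPairedᵇ sh j F c in eq
  ... | false = entryBracket≡closing⇒ j p , λ q → subst T eq (Equivalence.from (T-colPairedᵇ sh j F c) q)

colPaired? : ∀ {n} (sh : Shape n) j F c → Dec (ColPaired sh j F c)
colPaired? sh j F c = map′ (Equivalence.to (T-colPairedᵇ sh j F c)) (Equivalence.from (T-colPairedᵇ sh j F c)) (T? _)

bracketOf-cong : ∀ {n} (sh : Shape n) j {F G} c → F c ≡ G c → ColPaired sh j F c ⇔ ColPaired sh j G c →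
  bracketOf sh j F c ≡ bracketOf sh j G c
bracketOf-cong sh j {F} {G} c Fc≡Gc F⇔G with colPaired? sh j F c
... | yes p = trans (bracketOf-paired sh j F c p) (sym (bracketOf-paired sh j G c (Equivalence.to F⇔G p)))
... | no ¬p = begin
  bracketOf sh j F c     ≡⟨ bracketOf-unpaired sh j F c ¬p ⟩
  entryBracket j (F c)   ≡⟨ cong (entryBracket j) Fc≡Gc ⟩
  entryBracket j (G c)   ≡⟨ bracketOf-unpaired sh j G c (¬p ∘ Equivalence.from F⇔G) ⟨
  bracketOf sh j G c     ∎
  where open ≡-Reasoning

_≟ᶜ_ : (a b : Cell) → Dec (a ≡ b)
_≟ᶜ_ = ×-≡-dec Bool._≟_ (×-≡-dec ℕ._≟_ ℕ._≟_)

boolEq-sound : ∀ {t t′} → T (boolEq t t′) → t ≡ t′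
boolEq-sound {false} {false} _ = refl
boolEq-sound {true}  {true}  _ = refl

cellEq-sound : ∀ a b → T (cellEq a b) → a ≡ b
cellEq-sound (t , r , c) (t′ , r′ , c′) p
  with t≡ , q ← Equivalence.to T-∧ p with r≡ , c≡ ← Equivalence.to T-∧ q
  with refl ← boolEq-sound {t} t≡ | refl ← ≡ᵇ⇒≡ r r′ r≡ | refl ← ≡ᵇ⇒≡ c c′ c≡ = refl

cellEq-refl : ∀ a → T (cellEq a a)
cellEq-refl (false , r , c) = Equivalence.from T-∧ (≡⇒≡ᵇ r r refl , ≡⇒≡ᵇ c c refl)
cellEq-refl (true  , r , c) = Equivalence.from T-∧ (≡⇒≡ᵇ r r refl , ≡⇒≡ᵇ c c refl)

update-same : ∀ F u v → update F u v u ≡ v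
update-same F u v with cellEq u u in eq
... | true  = refl
... | false = ⊥-elim (subst T eq (cellEq-refl u))

update-other : ∀ F u v {c} → c ≢ u → update F u v c ≡ F c
update-other F u v {c} c≢u with cellEq c u in eq
... | true  = ⊥-elim (c≢u (cellEq-sound c u (subst T (sym eq) _)))
... | false = refl

f-just⁻ : ∀ {n} (sh : Shape n) j F {G} → f sh j F ≡ just G →
  Σ Cell (λ u → last (unpaired sh j F) ≡ just u × G ≡ update F u (suc j))
f-just⁻ sh j F p with last (unpaired sh j F)
f-just⁻ sh j F refl | just u = u , refl , refl

f-nothing⁻ : ∀ {n} (sh : Shape n) j F → f sh j F ≡ nothing → last (unpaired sh j F) ≡ nothing
f-nothing⁻ sh j F p with last (unpaired sh j F)
... | nothing = refl
f-nothing⁻ sh j F () | just _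

2+n≢n : ∀ {n} → suc (suc n) ≢ n
2+n≢n {n} = m≢1+n+m n {1} ∘ sym

Raised : ℕ → Filling → Filling → Set
Raised j F G = ∀ c → G c ≡ F c ⊎ (F c ≡ j × G c ≡ suc j)

module RaisingStep {n} (sh : Shape n) {N} {x : Filling} (ss : Semistandard sh N x) (j : ℕ) where
  private
    R = readingCells sh
    column-strict = proj₂ (proj₂ ss)

  raised-j : ∀ {G} → Raised j x G → ∀ {c} → G c ≡ j → x c ≡ j
  raised-j raised {c} Gc≡j with raised c
  ... | inj₁ Gc≡xc       = trans (sym Gc≡xc) Gc≡j
  ... | inj₂ (_ , Gc≡1+j) = ⊥-elim (1+n≢n (trans (sym Gc≡1+j) Gc≡j))

  raised-no-j-above-j : ∀ {G} → Raised j x G → ∀ {a} → InShape sh a → InShape sh (below a) →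
    G (below a) ≡ j → G a ≢ j
  raised-no-j-above-j raised {t , r , c} a∈ b∈ Gb≡j Ga≡j =
    <-irrefl (trans (raised-j raised Ga≡j) (sym (raised-j raised Gb≡j))) (column-strict t r c a∈ b∈)

  module _ {G} (raised : Raised j x G) {u} (u-last : last (unmatchedᴮ (bracketOf sh j G) 0 R) ≡ just u) where
    lastUnmatched-∈ : u ∈ R
    lastUnmatched-∈ = unmatchedᴮ-⊆ _ 0 R (last-∈ _ u-last)

    private
      G′ = update G u (suc j)
      u∈sh = readingCells-inShape sh lastUnmatched-∈
      u-closing = bracketOf≡closing⇒ sh j G u (unmatchedᴮ-closing _ 0 R (last-∈ _ u-last))
      Gu≡j = proj₁ u-closing
      G′u≡1+j : G′ u ≡ suc j
      G′u≡1+j = update-same G u (suc j)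
      G′≡G : ∀ {c} → c ≢ u → G′ c ≡ G c
      G′≡G = update-other G u (suc j)

    lastUnmatched-entry : x u ≡ j
    lastUnmatched-entry = raised-j raised Gu≡j

    -- u is not column paired, and no j lies directly above a j.
    raise-colPaired : ∀ {c} → InShape sh c → c ≢ u → ColPaired sh j G c ⇔ ColPaired sh j G′ c
    raise-colPaired {c} c∈ c≢u = mk⇔ to from
      where
      to : ColPaired sh j G c → ColPaired sh j G′ c
      to (inj₁ (Gc , b∈ , Gb)) with below c ≟ᶜ u
      ... | yes refl = ⊥-elim (1+n≢n (trans (sym Gb) Gu≡j))
      ... | no b≢u   = inj₁ (trans (G′≡G c≢u) Gc , b∈ , trans (G′≡G b≢u) Gb)
      to (inj₂ p) = inj₂ (above c∈ c≢u p)
        where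
        above : ∀ {c} → InShape sh c → c ≢ u → PairedAbove sh j G c → PairedAbove sh j G′ c
        above {t , suc r , col} c∈ c≢u (Gc , a∈ , Ga) with (t , r , col) ≟ᶜ u
        ... | yes refl = ⊥-elim (proj₂ u-closing (inj₁ (Ga , c∈ , Gc)))
        ... | no a≢u   = trans (G′≡G c≢u) Gc , a∈ , trans (G′≡G a≢u) Ga
      from : ColPaired sh j G′ c → ColPaired sh j G c
      from (inj₁ (G′c , b∈ , G′b)) with below c ≟ᶜ u
      ... | yes refl = ⊥-elim (raised-no-j-above-j raised c∈ b∈ Gu≡j (trans (sym (G′≡G c≢u)) G′c))
      ... | no b≢u   = inj₁ (trans (sym (G′≡G c≢u)) G′c , b∈ , trans (sym (G′≡G b≢u)) G′b)
      from (inj₂ p) = inj₂ (above c≢u p)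
        where
        above : ∀ {c} → c ≢ u → PairedAbove sh j G′ c → PairedAbove sh j G c
        above {t , suc r , col} c≢u (G′c , a∈ , G′a) with (t , r , col) ≟ᶜ u
        ... | yes refl = ⊥-elim (1+n≢n (trans (sym G′u≡1+j) G′a))
        ... | no a≢u   = trans (sym (G′≡G c≢u)) G′c , a∈ , trans (sym (G′≡G a≢u)) G′a

    raise-bracket-stable : ∀ {c} → c ∈ R → c ≢ u → bracketOf sh j G′ c ≡ bracketOf sh j G c
    raise-bracket-stable {c} c∈R c≢u =
      sym (bracketOf-cong sh j c (sym (G′≡G c≢u)) (raise-colPaired (readingCells-inShape sh c∈R) c≢u))

    raise-bracket-opening : bracketOf sh j G′ u ≡ opening
    raise-bracket-opening = trans (bracketOf-unpaired sh j G′ u ¬paired) (entryBracket-opening j G′u≡1+j)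
      where
      ¬paired : ¬ ColPaired sh j G′ u
      ¬paired (inj₁ (G′u≡j , _)) = 1+n≢n (trans (sym G′u≡1+j) G′u≡j)
      ¬paired (inj₂ p) = above refl p
        where
        above : ∀ {c} → c ≡ u → PairedAbove sh j G′ c → ⊥
        above {t , suc r , col} refl (_ , a∈ , G′a) =
          raised-no-j-above-j raised a∈ u∈sh Gu≡j (trans (sym (G′≡G λ { () })) G′a)

    raise-unmatched-≺ : ∀ {w} → w ∈ unmatchedᴮ (bracketOf sh j G′) 0 R → w ≺ u
    raise-unmatched-≺ =
      lastUnmatched-opened _ (readingCells-sorted sh) _ u-last raise-bracket-opening raise-bracket-stable

  module Iteration {d} (d-last : last (unpaired sh j x) ≡ just d) where
    d-last′ : last (unmatchedᴮ (bracketOf sh j x) 0 R) ≡ just d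
    d-last′ = subst (λ l → last l ≡ just d) (unpaired≡unmatchedᴮ sh j x) d-last

    record Invariant (G : Filling) : Set where
      field
        raised-upto-d : ∀ c → G c ≡ x c ⊎ (x c ≡ j × G c ≡ suc j × c ⪯ d)
        d-raised : G d ≡ suc j
        unmatched-≺-d : ∀ {w} → w ∈ unmatchedᴮ (bracketOf sh j G) 0 R → w ≺ d

      raised : Raised j x G
      raised c = Sum.map₂ (λ (xc , Gc , _) → xc , Gc) (raised-upto-d c)

    invariant-first : Invariant (update x d (suc j))
    invariant-first = record
      { raised-upto-d = raised-upto-d
      ; d-raised = update-same x d (suc j)
      ; unmatched-≺-d = raise-unmatched-≺ (λ _ → inj₁ refl) d-last′
      }
      where
      raised-upto-d : ∀ c → update x d (suc j) c ≡ x c ⊎ (x c ≡ j × update x d (suc j) c ≡ suc j × c ⪯ d)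
      raised-upto-d c with c ≟ᶜ d
      ... | yes refl = inj₂ (lastUnmatched-entry (λ _ → inj₁ refl) d-last′ , update-same x d (suc j) , inj₁ refl)
      ... | no c≢d   = inj₁ (update-other x d (suc j) c≢d)

    invariant-step : ∀ {G u} → Invariant G → last (unmatchedᴮ (bracketOf sh j G) 0 R) ≡ just u →
      Invariant (update G u (suc j))
    invariant-step {G} {u} inv u-last = record
      { raised-upto-d = raised-upto-d
      ; d-raised = trans (update-other G u (suc j) (λ d≡u → ≺-irrefl (sym d≡u) u≺d)) (Invariant.d-raised inv)
      ; unmatched-≺-d = λ w∈ → ≺-trans (raise-unmatched-≺ (Invariant.raised inv) u-last w∈) u≺d
      }
      where
      u≺d : u ≺ d
      u≺d = Invariant.unmatched-≺-d inv (last-∈ _ u-last)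
      raised-upto-d : ∀ c → update G u (suc j) c ≡ x c ⊎ (x c ≡ j × update G u (suc j) c ≡ suc j × c ⪯ d)
      raised-upto-d c with c ≟ᶜ u
      ... | yes refl = inj₂ (lastUnmatched-entry (Invariant.raised inv) u-last , update-same G u (suc j) , inj₂ u≺d)
      ... | no c≢u rewrite update-other G u (suc j) c≢u = Invariant.raised-upto-d inv c

    invariant : ∀ k {G} → fIter sh j (suc k) x ≡ just G → Invariant G
    invariant zero p with u , u-last , refl ← f-just⁻ sh j x p with refl ← trans (sym d-last) u-last = invariant-first
    invariant (suc k) {G} p with fIter sh j (suc k) x in eq
    ... | just G₀ with u , u-last , refl ← f-just⁻ sh j G₀ p =
      invariant-step (invariant k eq) (subst (λ l → last l ≡ just u) (unpaired≡unmatchedᴮ sh j G₀) u-last)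

module Lowering {n} (sh : Shape n) (i : ℕ) {F F′ : Filling} (raised : Raised (suc i) F F′) where

  data BracketChange (c : Cell) : Set where
    same           : bracketOf sh i F′ c ≡ bracketOf sh i F c → BracketChange c
    opening-raised : F c ≡ suc i → ¬ ColPaired sh i F c → F′ c ≡ suc (suc i) → BracketChange c
    pair-broken    : F c ≡ i → F′ c ≡ i → InShape sh (below c) →
                     F (below c) ≡ suc i → F′ (below c) ≡ suc (suc i) → BracketChange c

  private
    Fc≡i : ∀ {c} → F′ c ≡ i → F c ≡ i
    Fc≡i {c} F′c with raised c
    ... | inj₁ F′≡F       = trans (sym F′≡F) F′c
    ... | inj₂ (_ , F′c′) = ⊥-elim (2+n≢n (trans (sym F′c′) F′c))

    F′c≡i : ∀ {c} → F c ≡ i → F′ c ≡ i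
    F′c≡i {c} Fc with raised c
    ... | inj₁ F′≡F      = trans F′≡F Fc
    ... | inj₂ (Fc′ , _) = ⊥-elim (1+n≢n (trans (sym Fc′) Fc))

    colPaired-kept : ∀ {c} → F′ c ≡ F c → F c ≢ i → ColPaired sh i F′ c ⇔ ColPaired sh i F c
    colPaired-kept {t , zero , col} F′≡F Fc≢i =
      mk⇔ (λ { (inj₁ (F′c , _)) → ⊥-elim (Fc≢i (trans (sym F′≡F) F′c)) ; (inj₂ ()) })
          (λ { (inj₁ (Fc , _)) → ⊥-elim (Fc≢i Fc) ; (inj₂ ()) })
    colPaired-kept {t , suc r , col} F′≡F Fc≢i =
      mk⇔ (λ { (inj₁ (F′c , _)) → ⊥-elim (Fc≢i (trans (sym F′≡F) F′c))
             ; (inj₂ (F′c , a∈ , F′a)) → inj₂ (trans (sym F′≡F) F′c , a∈ , Fc≡i F′a) })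
          (λ { (inj₁ (Fc , _)) → ⊥-elim (Fc≢i Fc)
             ; (inj₂ (Fc , a∈ , Fa)) → inj₂ (trans F′≡F Fc , a∈ , F′c≡i Fa) })

    bracketChange-raised : ∀ {c} → F c ≡ suc i → F′ c ≡ suc (suc i) → BracketChange c
    bracketChange-raised {c} Fc F′c with colPaired? sh i F c
    ... | no ¬p = opening-raised Fc ¬p F′c
    ... | yes p = same (trans (bracketOf-neutral sh i F′ c (2+n≢n ∘ trans (sym F′c)) (1+n≢n ∘ trans (sym F′c)))
                              (sym (bracketOf-paired sh i F c p)))

    bracketChange-kept-i : ∀ {c} → F′ c ≡ F c → F c ≡ i → BracketChange c
    bracketChange-kept-i {c} F′≡F Fc with colPaired? sh i F′ c | colPaired? sh i F c
    ... | yes (inj₂ p′) | _ = ⊥-elim (1+n≢n (trans (sym (PairedAbove⇒entry sh i F′ c p′)) (trans F′≡F Fc)))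
    ... | _ | yes (inj₂ p) = ⊥-elim (1+n≢n (trans (sym (PairedAbove⇒entry sh i F c p)) Fc))
    ... | yes (inj₁ (F′c , b∈ , F′b)) | _ =
      same (trans (bracketOf-paired sh i F′ c (inj₁ (F′c , b∈ , F′b)))
                  (sym (bracketOf-paired sh i F c (inj₁ (Fc , b∈ , Fb)))))
      where
      Fb : F (below c) ≡ suc i
      Fb with raised (below c)
      ... | inj₁ F′b≡Fb    = trans (sym F′b≡Fb) F′b
      ... | inj₂ (_ , F′b′) = ⊥-elim (1+n≢n (trans (sym F′b′) F′b))
    ... | no ¬p′ | no ¬p =
      same (trans (bracketOf-unpaired sh i F′ c ¬p′)
                 (trans (cong (entryBracket i) F′≡F) (sym (bracketOf-unpaired sh i F c ¬p))))
    ... | no ¬p′ | yes (inj₁ (_ , b∈ , Fb)) with raised (below c)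
    ...   | inj₁ F′b≡Fb   = ⊥-elim (¬p′ (inj₁ (trans F′≡F Fc , b∈ , trans F′b≡Fb Fb)))
    ...   | inj₂ (_ , F′b) = pair-broken Fc (trans F′≡F Fc) b∈ Fb F′b

  bracketChange : ∀ c → BracketChange c
  bracketChange c with raised c
  ... | inj₂ (Fc , F′c) = bracketChange-raised Fc F′c
  ... | inj₁ F′≡F with F c ≟ i
  ...   | yes Fc  = bracketChange-kept-i F′≡F Fc
  ...   | no Fc≢i = same (bracketOf-cong sh i c F′≡F (colPaired-kept F′≡F Fc≢i))

  bracket-lowers : ∀ c → bracketOf sh i F′ c ⊑ bracketOf sh i F c
  bracket-lowers c with bracketChange c
  ... | same eq = ≤-reflexive (cong weight eq)
  ... | opening-raised Fc ¬p F′c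
    rewrite bracketOf-neutral sh i F′ c (2+n≢n ∘ trans (sym F′c)) (1+n≢n ∘ trans (sym F′c))
          | bracketOf-unpaired sh i F c ¬p | entryBracket-opening i Fc = s≤s z≤n
  ... | pair-broken _ F′c _ _ F′b =
    subst (_⊑ bracketOf sh i F c) (sym (trans (bracketOf-unpaired sh i F′ c ¬p′) (entryBracket-closing i F′c))) z≤n
    where
    ¬p′ : ¬ ColPaired sh i F′ c
    ¬p′ (inj₁ (_ , _ , F′b′)) = 1+n≢n (trans (sym F′b) F′b′)
    ¬p′ (inj₂ p) = 1+n≢n (trans (sym (PairedAbove⇒entry sh i F′ c p)) F′c)

module _ {n} {sh : Shape n} (valid : ValidShape sh) {N} {x : Filling} (ss : Semistandard sh N x) {i : ℕ} where
  open Semistandardness valid ss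

  PairedBelow-leftward : ∀ {c e} → InShape sh (below c) → x (below c) ≡ suc i →
    InShape sh e → x e ≡ i → level e ≡ level c → column e ≤ column c → PairedBelow sh i x e
  PairedBelow-leftward {t , r , col} {te , re , ce} b∈ xb e∈ xe ℓe≡ℓc ce≤col
    with refl , refl ← level-injective {te} {t} {re} {r} {ce} {col} ℓe≡ℓc
    with b′∈ , xb′ ← squeeze-below ce≤col e∈ b∈ xe xb = xe , b′∈ , xb′

  -- d cannot lie in the row of below c, where it would be paired above; so e lies at
  -- most in the row of c, and there it would be paired below unless it is right of c.
  column-pair-≺ : ∀ {c d e} → InShape sh c → InShape sh (below c) → x c ≡ i → x (below c) ≡ suc i →
    InShape sh d → x d ≡ suc i → ¬ PairedAbove sh i x d →
    InShape sh e → x e ≡ i → ¬ PairedBelow sh i x e →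
    below c ≺ d → d ≺ e → c ≺ e
  column-pair-≺ {t , r , col} {td , rd , cd} c∈ b∈ xc xb d∈ xd ¬pd e∈ xe ¬pe (by-column eq col<cd) _
    with refl , refl ← level-injective {t} {td} {suc r} {rd} {col} {cd} eq
    with a∈ , xa ← squeeze-above (<⇒≤ col<cd) c∈ d∈ xc xd = ⊥-elim (¬pd (xd , a∈ , xa))
  column-pair-≺ {c} {d} {e} c∈ b∈ xc xb d∈ xd ¬pd e∈ xe ¬pe (by-level ℓd<ℓb) d≺e
    with ℓe<ℓd ← ≺⇒level< d∈ e∈ (subst₂ _<_ (sym xe) (sym xd) (n<1+n i)) d≺e
    with m≤n⇒m<n∨m≡n (≤-pred (≤-trans ℓe<ℓd (≤-pred (subst (level d <_) (level-below c) ℓd<ℓb))))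
  ... | inj₁ ℓe<ℓc = by-level ℓe<ℓc
  ... | inj₂ ℓe≡ℓc with <-cmp (column c) (column e)
  ...   | tri< col< _ _ = by-column (sym ℓe≡ℓc) col<
  ...   | tri≈ _ col≡ _ = ⊥-elim (¬pe (PairedBelow-leftward b∈ xb e∈ xe ℓe≡ℓc (≤-reflexive (sym col≡))))
  ...   | tri> _ _ col> = ⊥-elim (¬pe (PairedBelow-leftward b∈ xb e∈ xe ℓe≡ℓc (<⇒≤ col>)))

module FirstRaise {n} {sh : Shape n} (valid : ValidShape sh) {N} {x : Filling} (ss : Semistandard sh N x) {i : ℕ}
  {d} (d-last : last (unpaired sh (suc i) x) ≡ just d) where
  open RaisingStep sh ss (suc i)
  open Iteration d-last
  private
    R = readingCells sh
    unmatchedᵢ : Filling → List Cell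
    unmatchedᵢ F = unmatchedᴮ (bracketOf sh i F) 0 R

  y₁ : Filling
  y₁ = update x d (suc (suc i))

  x-raised : Raised (suc i) x x
  x-raised _ = inj₁ refl

  d∈R : d ∈ R
  d∈R = lastUnmatched-∈ x-raised d-last′

  xd : x d ≡ suc i
  xd = lastUnmatched-entry x-raised d-last′

  y₁d : y₁ d ≡ suc (suc i)
  y₁d = update-same x d (suc (suc i))

  y₁-raised : Raised (suc i) x y₁
  y₁-raised = Invariant.raised invariant-first

  y₁≡x : ∀ {c} → c ≢ d → y₁ c ≡ x c
  y₁≡x = update-other x d (suc (suc i))

  -- Why e, paired in x, is unpaired in y₁: d's opening vanished before e, or d was
  -- the i+1 paired below an i at or before e.
  data UnpairingOf (e : Cell) : Set where
    d-unpaired : ¬ ColPaired sh i x d → d ≺ e → UnpairingOf e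
    d-below    : ∀ {c} → below c ≡ d → c ⪯ e → UnpairingOf e

  unpairing : ∀ {e} → x e ≡ i → e ∉ unmatchedᵢ x → e ∈ unmatchedᵢ y₁ → UnpairingOf e
  unpairing {e} xe e∉ e∈ with unmatchedᴮ-or-change (bracketOf sh i y₁) (bracketOf sh i x) (readingCells-sorted sh) 0 e∈
  ... | inj₁ e∈′ = ⊥-elim (e∉ e∈′)
  ... | inj₂ (c , c∈R , c⪯e , bracket≢) with Lowering.bracketChange sh i y₁-raised c
  ...   | Lowering.same eq = ⊥-elim (bracket≢ eq)
  ...   | Lowering.opening-raised xc ¬p y₁c with c ≟ᶜ d
  ...     | no c≢d = ⊥-elim (1+n≢n (trans (sym y₁c) (trans (y₁≡x c≢d) xc)))
  ...     | yes refl = d-unpaired ¬p (≺-of-⪯ c⪯e)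
    where
    ≺-of-⪯ : d ⪯ e → d ≺ e
    ≺-of-⪯ (inj₁ refl) = ⊥-elim (1+n≢n (trans (sym xd) xe))
    ≺-of-⪯ (inj₂ d≺e)  = d≺e
  unpairing xe e∉ e∈ | inj₂ (c , c∈R , c⪯e , _) | Lowering.pair-broken _ _ _ xb y₁b with below c ≟ᶜ d
  ... | yes b≡d = d-below b≡d c⪯e
  ... | no b≢d  = ⊥-elim (1+n≢n (trans (sym y₁b) (trans (y₁≡x b≢d) xb)))

  unpairing-≺ : ∀ {e} → UnpairingOf e → d ≺ e
  unpairing-≺ (d-unpaired _ d≺e)          = d≺e
  unpairing-≺ (d-below {c} refl c⪯e) = ≺-⪯-trans (below-≺ c) c⪯e

  module _ {y} (inv : Invariant y) where

    y-from-y₁ : ∀ c → y c ≡ y₁ c ⊎ (y₁ c ≡ suc i × y c ≡ suc (suc i) × c ≺ d)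
    y-from-y₁ c with c ≟ᶜ d
    ... | yes refl = inj₁ (trans (Invariant.d-raised inv) (sym y₁d))
    ... | no c≢d with Invariant.raised-upto-d inv c
    ...   | inj₁ yc≡xc               = inj₁ (trans yc≡xc (sym (y₁≡x c≢d)))
    ...   | inj₂ (_ , _ , inj₁ c≡d)  = ⊥-elim (c≢d c≡d)
    ...   | inj₂ (xc , yc , inj₂ c≺d) = inj₂ (trans (y₁≡x c≢d) xc , yc , c≺d)

    y-raised : Raised (suc i) y₁ y
    y-raised c = Sum.map₂ (λ (y₁c , yc , _) → y₁c , yc) (y-from-y₁ c)

    raised-≺ : ∀ {c} → y₁ c ≡ suc i → y c ≡ suc (suc i) → c ≺ d
    raised-≺ {c} y₁c yc with y-from-y₁ c
    ... | inj₁ yc≡y₁c        = ⊥-elim (1+n≢n (trans (sym yc) (trans yc≡y₁c y₁c)))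
    ... | inj₂ (_ , _ , c≺d) = c≺d

    module _ {e} (e∈R : e ∈ R) (xe : x e ≡ i) (e∈ : e ∈ unmatchedᵢ y₁) where
      private
        e∈sh = readingCells-inShape sh e∈R
        d∈sh = readingCells-inShape sh d∈R
        e≢d : e ≢ d
        e≢d refl = 1+n≢n (trans (sym xd) xe)
        ¬p₁e : ¬ ColPaired sh i y₁ e
        ¬p₁e = proj₂ (bracketOf≡closing⇒ sh i y₁ e (unmatchedᴮ-closing _ 0 R e∈))

      ¬PairedBelow-e : ¬ ColPaired sh i x d → ¬ PairedBelow sh i x e
      ¬PairedBelow-e ¬pd (_ , b∈ , xb) with below e ≟ᶜ d
      ... | yes refl = ¬pd (inj₂ (xb , e∈sh , xe))
      ... | no b≢d  = ¬p₁e (inj₁ (trans (y₁≡x e≢d) xe , b∈ , trans (y₁≡x b≢d) xb))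

      broken-pair-≺ : UnpairingOf e → ∀ {c} → c ∈ R → y₁ c ≡ i → InShape sh (below c) → y₁ (below c) ≡ suc i →
        below c ≺ d → c ≺ e
      broken-pair-≺ (d-below {c₀} refl c₀⪯e) _ _ _ _ b≺d = ≺-⪯-trans (below-≺-below⁻ b≺d) c₀⪯e
      broken-pair-≺ (d-unpaired ¬pd d≺e) {c} c∈R y₁c b∈ y₁b b≺d =
        column-pair-≺ valid ss (readingCells-inShape sh c∈R) b∈ xc xb d∈sh xd (¬pd ∘ inj₂)
                      e∈sh xe (¬PairedBelow-e ¬pd) b≺d d≺e
        where
        xc : x c ≡ i
        xc = trans (sym (y₁≡x λ { refl → 2+n≢n (trans (sym y₁d) y₁c) })) y₁c
        xb : x (below c) ≡ suc i
        xb = trans (sym (y₁≡x λ b≡d → ≺-irrefl b≡d b≺d)) y₁b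

      bracket-changed-≺ : UnpairingOf e → ∀ {c} → c ∈ R → bracketOf sh i y c ≢ bracketOf sh i y₁ c → c ≺ e
      bracket-changed-≺ unp {c} c∈R bracket≢ with Lowering.bracketChange sh i y-raised c
      ... | Lowering.same eq = ⊥-elim (bracket≢ eq)
      ... | Lowering.opening-raised y₁c _ yc = ≺-trans (raised-≺ y₁c yc) (unpairing-≺ unp)
      ... | Lowering.pair-broken y₁c _ b∈ y₁b yb = broken-pair-≺ unp c∈R y₁c b∈ y₁b (raised-≺ y₁b yb)

      lastUnmatched-preserved : e ∉ unmatchedᵢ x →
        Σ Cell (λ e′ → last (unmatchedᵢ y) ≡ just e′ × e′ ∈ unmatchedᵢ y₁)
      lastUnmatched-preserved e∉ with L₁ , L₁-last ← ∈⇒last e∈ =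
        L₁ , lastUnmatched-stable _ sorted _ L₁-last lowers unchanged , last-∈ _ L₁-last
        where
        sorted = readingCells-sorted sh
        e⪯L₁ = lastUnmatched-maximal _ sorted L₁-last e∈
        lowers : ∀ {c} → c ∈ R → bracketOf sh i y c ⊑ bracketOf sh i y₁ c
        lowers {c} _ = Lowering.bracket-lowers sh i y-raised c
        unchanged : ∀ {c} → c ∈ R → ¬ c ≺ L₁ → bracketOf sh i y c ≡ bracketOf sh i y₁ c
        unchanged {c} c∈R c⊀L₁ with bracketOf sh i y c ≟ᴮ bracketOf sh i y₁ c
        ... | yes eq = eq
        ... | no  ne = ⊥-elim (c⊀L₁ (≺-⪯-trans (bracket-changed-≺ (unpairing xe e∉ e∈) c∈R ne) e⪯L₁))

  fStar-invariant : ∀ {y} → FStar sh (suc i) x y → Invariant y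
  fStar-invariant (zero  , refl , f≡nothing) with () ← trans (sym d-last) (f-nothing⁻ sh (suc i) x f≡nothing)
  fStar-invariant (suc k , y≡ , _)          = invariant k y≡

  lastUnpaired-preserved : ∀ {y} → Invariant y → ∀ {e} → e ∈ R → x e ≡ i →
    e ∉ unpaired sh i x → e ∈ unpaired sh i y₁ →
    Σ Cell (λ e′ → last (unpaired sh i y) ≡ just e′ × e′ ∈ unpaired sh i y₁)
  lastUnpaired-preserved {y} inv e∈R xe e∉ e∈
    rewrite unpaired≡unmatchedᴮ sh i x | unpaired≡unmatchedᴮ sh i y₁ | unpaired≡unmatchedᴮ sh i y
    = lastUnmatched-preserved inv e∈R xe e∈ e∉

lemma5p6 : {n : ℕ} (sh : Shape n) (N : ℕ) (b : Vec ℕ (2 * n)) →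
    ValidShape sh → IsFlag {n} b →
    (x : Filling) → IsShuffleTableau sh N b x →
    (i : ℕ) (y₁ : Filling) → f sh (suc i) x ≡ just y₁ →
    (e : Cell) → Unpaired sh i y₁ e → Paired sh i x e →
    (y : Filling) → FStar sh (suc i) x y →
    Σ Cell (λ e′ → last (unpaired sh i y) ≡ just e′ × Unpaired sh i y₁ e′)
lemma5p6 sh N b valid _ x (ss , _) i y₁ f≡y₁ e e-unpaired (e∈R , xe , e-paired) y y≡f*x
  with d , d-last , refl ← f-just⁻ sh (suc i) x f≡y₁ =
  lastUnpaired-preserved (fStar-invariant y≡f*x) e∈R xe e-paired e-unpaired
  where open FirstRaise valid ss d-last
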